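{- Let $T_l$ and $T_r$ be red-black trees and $k$ a key, and run the red-black join algorithm $\mathrm{join}(T_l,k,T_r)$ described in the context. Then the algorithm works correctly, i.e. it returns a binary tree whose in-order sequence is the in-order sequence of $T_l$, followed by $k$, followed by the in-order sequence of $T_r$; it runs with $O(|r(T_l)-r(T_r)|)$ work; and the returned tree satisfies the red-black invariants and has rank at most $1+\max(r(T_l),r(T_r))$.
   Context: A binary tree is either the empty tree $\mathrm{Leaf}$ or a node $\mathrm{Node}(L,k,R)$ with left subtree $L$, key $k$, right subtree $R$; $L(T),k(T),R(T)$ denote these components of a nonempty $T$, and $\mathrm{expose}(T)=(L(T),k(T),R(T))$. The in-order sequence of $\mathrm{Node}(L,k,R)$ is that of $L$, then $k$, then that of $R$. $\mathrm{rotateLeft}(\mathrm{Node}(A,x,\mathrm{Node}(B,y,C)))=\mathrm{Node}(\mathrm{Node}(A,x,B),y,C)$. A red-black (RB) tree is a binary tree in which every node is colored red or black (leaves count as black) such that (red rule) no red node has a red child, and (black rule) every downward path from a node to a leaf contains the same number of black nodes; the root is NOT required to be black. The black height $\mathrm{bh}(T)$ is the number of black nodes on a downward path from the root of $T$ to a leaf, including the root (and $\mathrm{bh}(\mathrm{Leaf})=0$). The rank is $r(T)=2(\mathrm{bh}(T)-1)$ if the root of $T$ is black and $r(T)=2\,\mathrm{bh}(T)-1$ if it is red. Each node stores its color and black height; expose, node creation, recoloring and rotations cost $O(1)$ work. RB join algorithm $\mathrm{join}(T_l,k,T_r)$: If $\mathrm{bh}(T_l)=\mathrm{bh}(T_r)$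 (i.e. $\lfloor r(T_l)/2\rfloor=\lfloor r(T_r)/2\rfloor$), return $\mathrm{Node}(T_l,k,T_r)$ with $k$ colored red if both roots of $T_l$ and $T_r$ are black, and black otherwise. If $\mathrm{bh}(T_l)>\mathrm{bh}(T_r)$: walk down the right spine of $T_l$ to the first black node $c$ with $\mathrm{bh}(c)=\mathrm{bh}(T_r)$ and replace the subtree $c$ by the red node $\mathrm{Node}(c,k,T_r)$; then, going back up the path towards the root of $T_l$, whenever a black node $v$ has $R(v)$ and $R(R(v))$ both red, color $R(R(v))$ black and replace the subtree at $v$ by $\mathrm{rotateLeft}$ of it; finally, if the resulting root is red and has a red right child, recolor the root black. The case $\mathrm{bh}(T_r)>\mathrm{bh}(T_l)$ is the mirror image (walking down the left spine of $T_r$). -}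

module Defs where

open import Data.Nat using (ℕ; zero; suc; _+_; _*_; _≟_)
open import Data.Nat.Properties using (<-cmp)
open import Data.Integer as ℤ using (ℤ)
open import Data.Bool using (Bool; true; false; _∧_)
open import Data.List using (List; []; _∷_; _++_; map)
open import Data.List.Membership.Propositional using (_∈_)
open import Data.Product using (_×_; _,_; proj₁; proj₂)
open import Relation.Nullary using (yes; no)
open import Relation.Binary using (tri<; tri≈; tri>)
open import Relation.Binary.PropositionalEquality using (_≡_)

data Color : Set where
  red black : Color

data Tree (A : Set) : Set where
  leaf : Tree A
  node : Color → Tree A → A → Tree A → Tree A

module _ {A : Set} where

  inorder : Tree A → List A
  inorder leaf           = []
  inorder (node _ l k r) = inorder l ++ k ∷ inorder r

  -- leaves count as black
  isRed : Tree A → Bool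
  isRed (node red _ _ _) = true
  isRed _                = false

  isBlack : Tree A → Bool
  isBlack (node red _ _ _) = false
  isBlack _                = true

  blackVal : Color → ℕ
  blackVal red   = 0
  blackVal black = 1

  data RedRule : Tree A → Set where
    leaf  : RedRule leaf
    node  : ∀ {c l k r} → RedRule l → RedRule r →
            (c ≡ red → isRed l ≡ false × isRed r ≡ false) →
            RedRule (node c l k r)

  blackCounts : Tree A → List ℕ
  blackCounts leaf           = 0 ∷ []
  blackCounts (node c l _ r) = map (λ n → blackVal c + n) (blackCounts l ++ blackCounts r)

  SamePathCounts : Tree A → Set
  SamePathCounts t = ∀ {m n} → m ∈ blackCounts t → n ∈ blackCounts t → m ≡ n

  data BlackRule : Tree A → Set where
    leaf : BlackRule leaf
    node : ∀ {c l k r} → BlackRule l → BlackRule r →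
           SamePathCounts (node c l k r) → BlackRule (node c l k r)

  -- red-black tree (root not required to be black)
  IsRB : Tree A → Set
  IsRB t = RedRule t × BlackRule t

  -- black height: black nodes on a downward path (here the left spine)
  -- from the root to a leaf, including the root; bh leaf = 0.
  -- (Well defined for trees satisfying the black rule.)
  bh : Tree A → ℕ
  bh leaf           = 0
  bh (node c l _ _) = blackVal c + bh l

  rank : Tree A → ℤ
  rank t@(node red _ _ _) = ℤ.+ (2 * bh t) ℤ.- ℤ.+ 1
  rank t                  = ℤ.+ (2 * bh t) ℤ.- ℤ.+ 2

  -- Unit cost: each exposed/created node on the walked spine, including
  -- the O(1) comparison of stored black heights, the rebalancing step
  -- and the final root fix.

  rotateLeft : Tree A → Tree A
  rotateLeft (node c₁ a x (node c₂ b y c)) = node c₂ (node c₁ a x b) y c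
  rotateLeft t = t

  rotateRight : Tree A → Tree A
  rotateRight (node c₂ (node c₁ a x b) y c) = node c₁ a x (node c₂ b y c)
  rotateRight t = t

  fixR : Tree A → Tree A
  fixR (node black a x (node red b y (node red c z d))) =
    rotateLeft (node black a x (node red b y (node black c z d)))
  fixR t = t

  fixL : Tree A → Tree A
  fixL (node black (node red (node red a x b) y c) z d) =
    rotateRight (node black (node red (node black a x b) y c) z d)
  fixL t = t

  joinRightW : Tree A → A → Tree A → Tree A × ℕ
  joinRightW leaf k tr with bh tr
  ... | zero  = node red leaf k tr , 1
  ... | suc _ = node red leaf k tr , 1   -- unreachable on valid inputs
  joinRightW t@(node black l x r) k tr with bh t ≟ bh tr
  ... | yes _ = node red t k tr , 1
  ... | no  _ = let res = joinRightW r k tr in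
                fixR (node black l x (proj₁ res)) , suc (proj₂ res)
  joinRightW (node red l x r) k tr =
    let res = joinRightW r k tr in node red l x (proj₁ res) , suc (proj₂ res)

  joinLeftW : Tree A → A → Tree A → Tree A × ℕ
  joinLeftW tl k leaf with bh tl
  ... | zero  = node red tl k leaf , 1
  ... | suc _ = node red tl k leaf , 1   -- unreachable on valid inputs
  joinLeftW tl k t@(node black l x r) with bh t ≟ bh tl
  ... | yes _ = node red tl k t , 1
  ... | no  _ = let res = joinLeftW tl k l in
                fixL (node black (proj₁ res) x r) , suc (proj₂ res)
  joinLeftW tl k (node red l x r) =
    let res = joinLeftW tl k l in node red (proj₁ res) x r , suc (proj₂ res)

  rootFixR : Tree A → Tree A
  rootFixR (node red l x r@(node red _ _ _)) = node black l x r
  rootFixR t = t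

  rootFixL : Tree A → Tree A
  rootFixL (node red l@(node red _ _ _) x r) = node black l x r
  rootFixL t = t

  joinW : Tree A → A → Tree A → Tree A × ℕ
  joinW tl k tr with <-cmp (bh tl) (bh tr)
  ... | tri≈ _ _ _ with isBlack tl ∧ isBlack tr
  ...   | true  = node red tl k tr , 1
  ...   | false = node black tl k tr , 1
  joinW tl k tr | tri> _ _ _ =
    let res = joinRightW tl k tr in rootFixR (proj₁ res) , suc (proj₂ res)
  joinW tl k tr | tri< _ _ _ =
    let res = joinLeftW tl k tr in rootFixL (proj₁ res) , suc (proj₂ res)

  join : Tree A → A → Tree A → Tree A
  join tl k tr = proj₁ (joinW tl k tr)

  work : Tree A → A → Tree A → ℕ
  work tl k tr = proj₂ (joinW tl k tr)

-- Walking down the right spine of the taller tree to the first black node c of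
-- the shorter tree's black height and replacing c by the red node (c, k, tr)
-- gives a tree that is red-black except for possibly one red node with a red
-- right child.  Each rebalancing step on the way up either removes this
-- violation or, by the rotation, lifts it two levels; the final recolouring of
-- the root removes it, raising the rank by at most one.  The walk takes at most
-- two steps per unit of black-height difference, hence O(1) work per unit of
-- rank difference.  The case bh(tr) > bh(tl) is reduced to this one by
-- mirroring all trees.
module Submission where

open import Defs
open import Data.Nat using (ℕ; zero; suc; _+_; _*_; _≤_; _<_; _≟_; z≤n; s≤s; ∣_-_∣)
import Data.Nat as ℕ
open import Data.Nat.Properties
  using ( ≤-refl; ≤-reflexive; ≤-trans; ≤-pred; <⇒≤; ≤∧≢⇒<; <⇒≢; n≤1+n; m≤n*m
        ; +-suc; *-suc; +-cancelˡ-≡; +-monoʳ-≤; *-monoʳ-≤; +-∸-assoc; m+n≤o⇒m≤o∸n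
        ; m≤n⇒∣n-m∣≡n∸m; m≤n⇒∣m-n∣≡n∸m; ∣-∣-comm; <-cmp; ≤-total
        ; m≤m⊔n; m≤n⊔m; ⊔-comm; ⊔-sel
        ; module ≤-Reasoning)
open import Data.Integer as ℤ using (ℤ; +_; ∣_∣; _⊔_; _⊖_)
import Data.Integer.Properties as ℤ
open import Data.Integer.Solver using (module +-*-Solver)
open import Data.Bool using (false; true)
open import Data.List using (List; []; _∷_; _++_; reverse)
open import Data.List.Properties using (++-assoc; reverse-++; unfold-reverse; reverse-involutive)
open import Data.List.Membership.Propositional using (_∈_)
open import Data.List.Membership.Propositional.Properties
  using (∈-map⁺; ∈-map⁻; ∈-++⁺ˡ; ∈-++⁺ʳ; ∈-++⁻)
open import Data.List.Relation.Unary.Any using (here)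
open import Data.Product using (Σ; ∃; _×_; _,_; proj₁; proj₂; map₁; map₂)
open import Data.Sum using (_⊎_; inj₁; inj₂)
open import Data.Empty using (⊥-elim)
open import Relation.Nullary using (yes; no)
open import Relation.Binary using (tri<; tri≈; tri>)
open import Relation.Binary.PropositionalEquality
open import Function using (_∘_)

m+n≤o+p⇒m≤o+∣p-n∣ : ∀ {m n o p} → n ≤ p → m + n ≤ o + p → m ≤ o + ∣ p - n ∣
m+n≤o+p⇒m≤o+∣p-n∣ {m} {n} {o} {p} n≤p m+n≤o+p = begin
  m               ≤⟨ m+n≤o⇒m≤o∸n m m+n≤o+p ⟩
  (o + p) ℕ.∸ n   ≡⟨ +-∸-assoc o n≤p ⟩
  o + (p ℕ.∸ n)   ≡⟨ cong (o ℕ.+_) (m≤n⇒∣n-m∣≡n∸m n≤p) ⟨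
  o + ∣ p - n ∣   ∎
  where open ≤-Reasoning

m+n≤m*[1+n] : ∀ m n .{{_ : ℕ.NonZero m}} → m + n ≤ m * suc n
m+n≤m*[1+n] m n = subst (m + n ≤_) (sym (*-suc m n)) (+-monoʳ-≤ m (m≤n*m n m))

∣m⊖n∣≡∣m-n∣ : ∀ m n → ∣ m ⊖ n ∣ ≡ ∣ m - n ∣
∣m⊖n∣≡∣m-n∣ m n with ≤-total m n
... | inj₁ m≤n = trans (ℤ.∣⊖∣-≤ m≤n) (sym (m≤n⇒∣m-n∣≡n∸m m≤n))
... | inj₂ n≤m =
  trans (ℤ.∣m⊖n∣≡∣n⊖m∣ m n) (trans (ℤ.∣⊖∣-≤ n≤m) (sym (m≤n⇒∣n-m∣≡n∸m n≤m)))

[i-k]-[j-k]≡i-j : ∀ i j k → (i ℤ.- k) ℤ.- (j ℤ.- k) ≡ i ℤ.- j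
[i-k]-[j-k]≡i-j = solve 3 (λ i j k → (i :- k) :- (j :- k) := i :- j) refl
  where open +-*-Solver

module _ {A : Set} where

  mutual
    data RBᵇ : ℕ → Tree A → Set where
      leaf : RBᵇ 0 leaf
      node : ∀ {n l k r} → RB n l → RB n r → RBᵇ (suc n) (node black l k r)

    data RB : ℕ → Tree A → Set where
      black : ∀ {n t} → RBᵇ n t → RB n t
      red   : ∀ {n l k r} → RBᵇ n l → RBᵇ n r → RB n (node red l k r)

  mutual
    bh-RBᵇ : ∀ {n t} → RBᵇ n t → bh t ≡ n
    bh-RBᵇ leaf        = refl
    bh-RBᵇ (node pl _) = cong suc (bh-RB pl)

    bh-RB : ∀ {n t} → RB n t → bh t ≡ n
    bh-RB (black p)  = bh-RBᵇ p
    bh-RB (red pl _) = bh-RBᵇ pl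

  bh≡⇒≡ : ∀ {m n s t} → RB m s → RB n t → bh s ≡ bh t → m ≡ n
  bh≡⇒≡ ps pt e = trans (sym (bh-RB ps)) (trans e (bh-RB pt))

  ≡⇒bh≡ : ∀ {m n s t} → RB m s → RB n t → m ≡ n → bh s ≡ bh t
  ≡⇒bh≡ ps pt e = trans (bh-RB ps) (trans e (sym (bh-RB pt)))

  RBᵇ-notRed : ∀ {n t} → RBᵇ n t → isRed t ≡ false
  RBᵇ-notRed leaf       = refl
  RBᵇ-notRed (node _ _) = refl

  RB⇒RBᵇ : ∀ {n t} → RB n t → isRed t ≡ false → RBᵇ n t
  RB⇒RBᵇ (black p) _ = p

  ∈blackCounts-nodeˡ : ∀ {m} c (l : Tree A) k r → m ∈ blackCounts l →
                       blackVal {A = A} c + m ∈ blackCounts (node c l k r)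
  ∈blackCounts-nodeˡ c l k r m∈ =
    ∈-map⁺ (blackVal {A = A} c ℕ.+_) (∈-++⁺ˡ {ys = blackCounts r} m∈)

  ∈blackCounts-nodeʳ : ∀ {m} c (l : Tree A) k r → m ∈ blackCounts r →
                       blackVal {A = A} c + m ∈ blackCounts (node c l k r)
  ∈blackCounts-nodeʳ c l k r m∈ =
    ∈-map⁺ (blackVal {A = A} c ℕ.+_) (∈-++⁺ʳ (blackCounts l) m∈)

  bh∈blackCounts : ∀ t → bh t ∈ blackCounts t
  bh∈blackCounts leaf           = here refl
  bh∈blackCounts (node c l k r) = ∈blackCounts-nodeˡ c l k r (bh∈blackCounts l)

  SamePathCounts⇒bh≡ : ∀ {c l k r} → SamePathCounts (node c l k r) → bh l ≡ bh r
  SamePathCounts⇒bh≡ {c} {l} {k} {r} same = +-cancelˡ-≡ (blackVal {A = A} c) _ _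
    (same (∈blackCounts-nodeˡ c l k r (bh∈blackCounts l))
          (∈blackCounts-nodeʳ c l k r (bh∈blackCounts r)))

  RB-node : ∀ {n l k r} c → (c ≡ red → isRed l ≡ false × isRed r ≡ false) →
            RB n l → RB n r → RB (blackVal {A = A} c + n) (node c l k r)
  RB-node black _     pl pr = black (node pl pr)
  RB-node red   noRed pl pr =
    red (RB⇒RBᵇ pl (proj₁ (noRed refl))) (RB⇒RBᵇ pr (proj₂ (noRed refl)))

  IsRB⇒RB : ∀ t → IsRB t → RB (bh t) t
  IsRB⇒RB leaf _ = black leaf
  IsRB⇒RB (node c l k r) (node rl rr noRed , node bl br same) =
    RB-node c noRed (IsRB⇒RB l (rl , bl))
      (subst (λ n → RB n r) (sym (SamePathCounts⇒bh≡ {c} {l} {k} {r} same)) (IsRB⇒RB r (rr , br)))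

  blackCounts-node : ∀ {n} c (l : Tree A) k r →
                     (∀ {m} → m ∈ blackCounts l → m ≡ n) →
                     (∀ {m} → m ∈ blackCounts r → m ≡ n) →
                     ∀ {m} → m ∈ blackCounts (node c l k r) → m ≡ blackVal {A = A} c + n
  blackCounts-node c l k r countsˡ countsʳ m∈ with ∈-map⁻ (blackVal {A = A} c ℕ.+_) m∈
  ... | _ , m∈lr , m≡ with ∈-++⁻ (blackCounts l) m∈lr
  ...   | inj₁ m∈l = trans m≡ (cong (blackVal {A = A} c ℕ.+_) (countsˡ m∈l))
  ...   | inj₂ m∈r = trans m≡ (cong (blackVal {A = A} c ℕ.+_) (countsʳ m∈r))

  mutual
    blackCounts-RBᵇ : ∀ {n t m} → RBᵇ n t → m ∈ blackCounts t → m ≡ n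
    blackCounts-RBᵇ leaf (here refl) = refl
    blackCounts-RBᵇ {t = node _ l k r} (node pl pr) =
      blackCounts-node black l k r (blackCounts-RB pl) (blackCounts-RB pr)

    blackCounts-RB : ∀ {n t m} → RB n t → m ∈ blackCounts t → m ≡ n
    blackCounts-RB (black p)   m∈ = blackCounts-RBᵇ p m∈
    blackCounts-RB {t = node _ l k r} (red pl pr) =
      blackCounts-node red l k r (blackCounts-RBᵇ pl) (blackCounts-RBᵇ pr)

  IsRB-node : ∀ {n c} {l r : Tree A} {k} → IsRB l → IsRB r →
              (c ≡ red → isRed l ≡ false × isRed r ≡ false) →
              (∀ {m} → m ∈ blackCounts (node c l k r) → m ≡ n) → IsRB (node c l k r)
  IsRB-node (rl , bl) (rr , br) noRed counts =
    node rl rr noRed , node bl br (λ m∈ m′∈ → trans (counts m∈) (sym (counts m′∈)))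

  mutual
    RBᵇ⇒IsRB : ∀ {n t} → RBᵇ n t → IsRB t
    RBᵇ⇒IsRB leaf           = leaf , leaf
    RBᵇ⇒IsRB p@(node pl pr) = IsRB-node (RB⇒IsRB pl) (RB⇒IsRB pr) (λ ()) (blackCounts-RBᵇ p)

    RB⇒IsRB : ∀ {n t} → RB n t → IsRB t
    RB⇒IsRB (black p)     = RBᵇ⇒IsRB p
    RB⇒IsRB p@(red pl pr) = IsRB-node (RBᵇ⇒IsRB pl) (RBᵇ⇒IsRB pr)
                              (λ _ → RBᵇ-notRed pl , RBᵇ-notRed pr) (blackCounts-RB p)

  -- rankℕ t = rank t + 2, which is a natural number
  rankℕ : Tree A → ℕ
  rankℕ t@(node red _ _ _) = suc (2 * bh t)
  rankℕ t                  = 2 * bh t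

  2*bh≤rankℕ : ∀ t → 2 * bh t ≤ rankℕ t
  2*bh≤rankℕ leaf               = ≤-refl
  2*bh≤rankℕ (node red _ _ _)   = n≤1+n _
  2*bh≤rankℕ (node black _ _ _) = ≤-refl

  2*n≤rankℕ-RB : ∀ {n t} → RB n t → 2 * n ≤ rankℕ t
  2*n≤rankℕ-RB {t = t} p = subst (λ m → 2 * m ≤ rankℕ t) (bh-RB p) (2*bh≤rankℕ t)

  rankℕ-RBᵇ : ∀ {n t} → RBᵇ n t → rankℕ t ≡ 2 * n
  rankℕ-RBᵇ leaf        = refl
  rankℕ-RBᵇ (node pl _) = cong (λ m → 2 * suc m) (bh-RB pl)

  rankℕ-red : ∀ {n a y b} → RB n (node red a y b) → rankℕ (node red a y b) ≡ suc (2 * n)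
  rankℕ-red (red pa _) = cong (λ m → suc (2 * m)) (bh-RBᵇ pa)

  rankℕ-RB : ∀ {n t} → RB n t → rankℕ t ≤ suc (2 * n)
  rankℕ-RB (black p)  = ≤-trans (≤-reflexive (rankℕ-RBᵇ p)) (n≤1+n _)
  rankℕ-RB p@(red _ _) = ≤-reflexive (rankℕ-red p)

  rankℕ-mono : ∀ {h H t T} → RB h t → RB H T → h < H → rankℕ t ≤ rankℕ T
  rankℕ-mono {h} {H} {t} {T} p q h<H = begin
    rankℕ t             ≤⟨ rankℕ-RB p ⟩
    suc (2 * h)         ≤⟨ n≤1+n _ ⟩
    suc (suc (2 * h))   ≡⟨ *-suc 2 h ⟨
    2 * suc h           ≤⟨ *-monoʳ-≤ 2 h<H ⟩
    2 * H               ≤⟨ 2*n≤rankℕ-RB q ⟩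
    rankℕ T             ∎
    where open ≤-Reasoning

  -- The right-leaning join

  joinRightW-leaf : ∀ k (tr : Tree A) → joinRightW leaf k tr ≡ (node red leaf k tr , 1)
  joinRightW-leaf k tr with bh tr
  ... | zero  = refl
  ... | suc _ = refl

  inorder-fixR : ∀ (t : Tree A) → inorder (fixR t) ≡ inorder t
  inorder-fixR leaf                                                = refl
  inorder-fixR (node red _ _ _)                                    = refl
  inorder-fixR (node black _ _ leaf)                               = refl
  inorder-fixR (node black _ _ (node black _ _ _))                 = refl
  inorder-fixR (node black _ _ (node red _ _ leaf))                = refl
  inorder-fixR (node black _ _ (node red _ _ (node black _ _ _)))  = refl
  inorder-fixR (node black a x (node red b y (node red c z d)))    =
    ++-assoc (inorder a) (x ∷ inorder b) (y ∷ inorder c ++ z ∷ inorder d)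

  inorder-rootFixR : ∀ (t : Tree A) → inorder (rootFixR t) ≡ inorder t
  inorder-rootFixR leaf                              = refl
  inorder-rootFixR (node black _ _ _)                = refl
  inorder-rootFixR (node red _ _ leaf)               = refl
  inorder-rootFixR (node red _ _ (node black _ _ _)) = refl
  inorder-rootFixR (node red _ _ (node red _ _ _))   = refl

  inorder-graftʳ : ∀ c l x (r r′ : Tree A) k tr → inorder r′ ≡ inorder r ++ k ∷ inorder tr →
                   inorder (node c l x r′) ≡ inorder (node c l x r) ++ k ∷ inorder tr
  inorder-graftʳ c l x r r′ k tr eq = begin
    inorder l ++ x ∷ inorder r′
      ≡⟨ cong (λ s → inorder l ++ x ∷ s) eq ⟩
    inorder l ++ x ∷ inorder r ++ k ∷ inorder tr
      ≡⟨ ++-assoc (inorder l) (x ∷ inorder r) (k ∷ inorder tr) ⟨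
    inorder (node c l x r) ++ k ∷ inorder tr
      ∎
    where open ≡-Reasoning

  inorder-joinRightW : ∀ (tl : Tree A) k tr →
                       inorder (proj₁ (joinRightW tl k tr)) ≡ inorder tl ++ k ∷ inorder tr
  inorder-joinRightW leaf k tr rewrite joinRightW-leaf k tr = refl
  inorder-joinRightW (node black l x r) k tr with suc (bh l) ≟ bh tr
  ... | yes _ = refl
  ... | no  _ = trans (inorder-fixR (node black l x r′))
                      (inorder-graftʳ black l x r r′ k tr (inorder-joinRightW r k tr))
    where r′ = proj₁ (joinRightW r k tr)
  inorder-joinRightW (node red l x r) k tr =
    inorder-graftʳ red l x r (proj₁ (joinRightW r k tr)) k tr (inorder-joinRightW r k tr)

  data AlmostRB : ℕ → Tree A → Set where
    valid   : ∀ {n t} → RB n t → AlmostRB n t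
    redRoot : ∀ {n l k r} → RBᵇ n l → RB n r → AlmostRB n (node red l k r)

  fixR-RB : ∀ {n l x r} → RB n l → AlmostRB n r → RB (suc n) (fixR (node black l x r))
  fixR-RB pl (valid (black leaf))            = black (node pl (black leaf))
  fixR-RB pl (valid (black (node p q)))      = black (node pl (black (node p q)))
  fixR-RB pl (valid (red pa leaf))           = black (node pl (red pa leaf))
  fixR-RB pl (valid (red pa (node p q)))     = black (node pl (red pa (node p q)))
  fixR-RB pl (redRoot pa (black leaf))       = black (node pl (red pa leaf))
  fixR-RB pl (redRoot pa (black (node p q))) = black (node pl (red pa (node p q)))
  fixR-RB pl (redRoot pa (red pc pd))        = red (node pl (black pa)) (node (black pc) (black pd))

  fixR-RB-red : ∀ {n l x a y r} → RB n l → RBᵇ n a → AlmostRB n r →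
                RB (suc n) (fixR (node black l x (node red a y r)))
  fixR-RB-red pl pa (valid (black leaf))       = black (node pl (red pa leaf))
  fixR-RB-red pl pa (valid (black (node p q))) = black (node pl (red pa (node p q)))
  fixR-RB-red pl pa (valid (red pc pd))        = red (node pl (black pa)) (node (black pc) (black pd))
  fixR-RB-red pl pa (redRoot pc pd)            = red (node pl (black pa)) (node (black pc) pd)

  mutual
    joinRightW-AlmostRB : ∀ {H h tl tr} k → RBᵇ H tl → RB h tr → h ≤ H →
                          AlmostRB H (proj₁ (joinRightW tl k tr))
    joinRightW-AlmostRB {tr = tr} k leaf q z≤n rewrite joinRightW-leaf k tr = redRoot leaf q
    joinRightW-AlmostRB {tr = tr} k p@(node {l = l} pl pr) q h≤ with suc (bh l) ≟ bh tr
    ... | yes e = redRoot p (subst (λ m → RB m tr) (sym (bh≡⇒≡ (black p) q e)) q)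
    ... | no ≢  =
      valid (fixR-joinRightW k pl pr q (≤-pred (≤∧≢⇒< h≤ (≢ ∘ ≡⇒bh≡ (black p) q ∘ sym))))

    fixR-joinRightW : ∀ {n h l x r tr} k → RB n l → RB n r → RB h tr → h ≤ n →
                      RB (suc n) (fixR (node black l x (proj₁ (joinRightW r k tr))))
    fixR-joinRightW k pl (black pr)  q h≤ = fixR-RB pl (joinRightW-AlmostRB k pr q h≤)
    fixR-joinRightW k pl (red pa pb) q h≤ = fixR-RB-red pl pa (joinRightW-AlmostRB k pb q h≤)

  joinRightW-RB : ∀ {n h tl tr} k → RBᵇ (suc n) tl → RB h tr → h ≤ n →
                  RB (suc n) (proj₁ (joinRightW tl k tr))
  joinRightW-RB {tr = tr} k p@(node {l = l} pl pr) q h≤ with suc (bh l) ≟ bh tr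
  ... | yes e = ⊥-elim (<⇒≢ (s≤s h≤) (bh≡⇒≡ q (black p) (sym e)))
  ... | no  _ = fixR-joinRightW k pl pr q h≤

  joinRightW-work : ∀ {H h tl tr} k → RB H tl → RB h tr → h ≤ H →
                    proj₂ (joinRightW tl k tr) + 2 * h ≤ suc (rankℕ tl)
  joinRightW-work {tr = tr} k (black leaf) q z≤n rewrite joinRightW-leaf k tr = ≤-refl
  joinRightW-work {h = h} {tr = tr} k (black p@(node {n} {l} {x} {r} pl pr)) q h≤ with suc (bh l) ≟ bh tr
  ... | yes _ = s≤s (≤-trans (*-monoʳ-≤ 2 h≤) (2*n≤rankℕ-RB (black p)))
  ... | no ≢  = begin
    suc (proj₂ (joinRightW r k tr) + 2 * h) ≤⟨ s≤s (joinRightW-work k pr q h≤n) ⟩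
    suc (suc (rankℕ r))                     ≤⟨ s≤s (s≤s (rankℕ-RB pr)) ⟩
    suc (suc (suc (2 * n)))                 ≡⟨ cong suc (*-suc 2 n) ⟨
    suc (2 * suc n)                         ≤⟨ s≤s (2*n≤rankℕ-RB (black p)) ⟩
    suc (rankℕ (node black l x r))          ∎
    where
      open ≤-Reasoning
      h≤n = ≤-pred (≤∧≢⇒< h≤ (≢ ∘ ≡⇒bh≡ (black p) q ∘ sym))
  joinRightW-work k p@(red _ pb) q h≤ =
    s≤s (≤-trans (joinRightW-work k (black pb) q h≤)
                 (≤-reflexive (trans (cong suc (rankℕ-RBᵇ pb)) (sym (rankℕ-red p)))))

  rootFixR-RB : ∀ {n t} → RB n t → rootFixR t ≡ t
  rootFixR-RB (black leaf)       = refl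
  rootFixR-RB (black (node _ _)) = refl
  rootFixR-RB (red _ leaf)       = refl
  rootFixR-RB (red _ (node _ _)) = refl

  rootFixR-red : ∀ {n a y r} → RBᵇ n a → RB n r →
                 RB n (rootFixR (node red a y r)) ⊎ RBᵇ (suc n) (rootFixR (node red a y r))
  rootFixR-red pa (black leaf)       = inj₁ (red pa leaf)
  rootFixR-red pa (black (node p q)) = inj₁ (red pa (node p q))
  rootFixR-red pa (red pc pd)        = inj₂ (node (black pa) (red pc pd))

  RB⊎RBᵇ-rankℕ : ∀ {n t} → RB n t ⊎ RBᵇ (suc n) t →
                 (∃ λ m → RB m t) × rankℕ t ≤ suc (suc (2 * n))
  RB⊎RBᵇ-rankℕ     (inj₁ p) = (_ , p) , ≤-trans (rankℕ-RB p) (n≤1+n _)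
  RB⊎RBᵇ-rankℕ {n} (inj₂ p) = (_ , black p) , ≤-reflexive (trans (rankℕ-RBᵇ p) (*-suc 2 n))

  joinRightW-rootFixR : ∀ {H h tl tr} k → RB H tl → RB h tr → h < H →
                        let t = rootFixR (proj₁ (joinRightW tl k tr)) in
                        (∃ λ m → RB m t) × rankℕ t ≤ suc (rankℕ tl)
  joinRightW-rootFixR {tl = tl} {tr} k (black p) q (s≤s h≤n)
    with proj₁ (joinRightW tl k tr) | joinRightW-RB k p q h≤n
  ... | _ | R rewrite rootFixR-RB R =
    (_ , R) , ≤-trans (rankℕ-RB R) (s≤s (≤-reflexive (sym (rankℕ-RBᵇ p))))
  joinRightW-rootFixR k p@(red pa pb) q (s≤s h≤n) =
    map₂ (λ rank≤ → ≤-trans rank≤ (≤-reflexive (cong suc (sym (rankℕ-red p)))))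
         (RB⊎RBᵇ-rankℕ (rootFixR-red pa (joinRightW-RB k pb q h≤n)))

  record JoinSpec (tl : Tree A) (k : A) (tr : Tree A) (t : Tree A) (w : ℕ) : Set where
    field
      inorder-≡ : inorder t ≡ inorder tl ++ k ∷ inorder tr
      isRB      : ∃ λ n → RB n t
      rankℕ≤    : rankℕ t ≤ suc (rankℕ tl ℕ.⊔ rankℕ tr)
      work≤     : w ≤ 3 + ∣ rankℕ tl - rankℕ tr ∣

  joinRight-spec : ∀ {H h} tl k tr → RB H tl → RB h tr → h < H →
                   JoinSpec tl k tr (rootFixR (proj₁ (joinRightW tl k tr))) (suc (proj₂ (joinRightW tl k tr)))
  joinRight-spec {h = h} tl k tr p q h<H = record
    { inorder-≡ = trans (inorder-rootFixR (proj₁ (joinRightW tl k tr))) (inorder-joinRightW tl k tr)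
    ; isRB      = proj₁ (joinRightW-rootFixR k p q h<H)
    ; rankℕ≤    = ≤-trans (proj₂ (joinRightW-rootFixR k p q h<H)) (s≤s (m≤m⊔n _ _))
    ; work≤     = m+n≤o+p⇒m≤o+∣p-n∣ (rankℕ-mono q p h<H) work+rankℕ≤
    }
    where
      w = proj₂ (joinRightW tl k tr)
      work+rankℕ≤ : suc w + rankℕ tr ≤ 3 + rankℕ tl
      work+rankℕ≤ = begin
        suc w + rankℕ tr        ≤⟨ +-monoʳ-≤ (suc w) (rankℕ-RB q) ⟩
        suc w + suc (2 * h)     ≡⟨ cong suc (+-suc w (2 * h)) ⟩
        suc (suc (w + 2 * h))   ≤⟨ s≤s (s≤s (joinRightW-work k p q (<⇒≤ h<H))) ⟩
        3 + rankℕ tl            ∎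
        where open ≤-Reasoning


  -- Mirror images

  mirror : Tree A → Tree A
  mirror leaf           = leaf
  mirror (node c l k r) = node c (mirror r) k (mirror l)

  mirror-involutive : ∀ t → mirror (mirror t) ≡ t
  mirror-involutive leaf           = refl
  mirror-involutive (node c l k r) =
    cong₂ (λ l′ r′ → node c l′ k r′) (mirror-involutive l) (mirror-involutive r)

  mutual
    RBᵇ-mirror : ∀ {n t} → RBᵇ n t → RBᵇ n (mirror t)
    RBᵇ-mirror leaf        = leaf
    RBᵇ-mirror (node pl pr) = node (RB-mirror pr) (RB-mirror pl)

    RB-mirror : ∀ {n t} → RB n t → RB n (mirror t)
    RB-mirror (black p)   = black (RBᵇ-mirror p)
    RB-mirror (red pl pr) = red (RBᵇ-mirror pr) (RBᵇ-mirror pl)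

  bh-mirror : ∀ {n t} → RB n t → bh (mirror t) ≡ bh t
  bh-mirror p = ≡⇒bh≡ (RB-mirror p) p refl

  rankℕ-mirror : ∀ {n t} → RB n t → rankℕ (mirror t) ≡ rankℕ t
  rankℕ-mirror {t = leaf}             _ = refl
  rankℕ-mirror {t = node red _ _ _}   p = cong (λ m → suc (2 * m)) (bh-mirror p)
  rankℕ-mirror {t = node black _ _ _} p = cong (2 *_) (bh-mirror p)

  reverse-++-∷ : ∀ (xs : List A) k ys → reverse (xs ++ k ∷ ys) ≡ reverse ys ++ k ∷ reverse xs
  reverse-++-∷ xs k ys = begin
    reverse (xs ++ k ∷ ys)            ≡⟨ reverse-++ xs (k ∷ ys) ⟩
    reverse (k ∷ ys) ++ reverse xs    ≡⟨ cong (_++ reverse xs) (unfold-reverse k ys) ⟩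
    (reverse ys ++ k ∷ []) ++ reverse xs ≡⟨ ++-assoc (reverse ys) (k ∷ []) (reverse xs) ⟩
    reverse ys ++ k ∷ reverse xs      ∎
    where open ≡-Reasoning

  inorder-mirror : ∀ t → inorder (mirror t) ≡ reverse (inorder t)
  inorder-mirror leaf           = refl
  inorder-mirror (node c l k r) =
    trans (cong₂ (λ xs ys → xs ++ k ∷ ys) (inorder-mirror r) (inorder-mirror l))
          (sym (reverse-++-∷ (inorder l) k (inorder r)))

  fixL-mirror : ∀ t → fixL (mirror t) ≡ mirror (fixR t)
  fixL-mirror leaf                                               = refl
  fixL-mirror (node red _ _ _)                                   = refl
  fixL-mirror (node black _ _ leaf)                              = refl
  fixL-mirror (node black _ _ (node black _ _ _))                = refl
  fixL-mirror (node black _ _ (node red _ _ leaf))               = refl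
  fixL-mirror (node black _ _ (node red _ _ (node black _ _ _))) = refl
  fixL-mirror (node black _ _ (node red _ _ (node red _ _ _)))   = refl

  rootFixL-mirror : ∀ t → rootFixL (mirror t) ≡ mirror (rootFixR t)
  rootFixL-mirror leaf                              = refl
  rootFixL-mirror (node black _ _ _)                = refl
  rootFixL-mirror (node red _ _ leaf)               = refl
  rootFixL-mirror (node red _ _ (node black _ _ _)) = refl
  rootFixL-mirror (node red _ _ (node red _ _ _))   = refl

  joinLeftW-leaf : ∀ (tl : Tree A) k → joinLeftW tl k leaf ≡ (node red tl k leaf , 1)
  joinLeftW-leaf tl k with bh tl
  ... | zero  = refl
  ... | suc _ = refl

  joinLeftW-mirror : ∀ {h H t T} k → RB h t → RB H T →
                     joinLeftW (mirror t) k (mirror T) ≡ map₁ mirror (joinRightW T k t)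
  joinLeftW-mirror {t = t} k q (black leaf) rewrite joinLeftW-leaf (mirror t) k | joinRightW-leaf k t = refl
  joinLeftW-mirror {t = t} k q p@(black (node {l = l} {x} {r} pl pr))
    with suc (bh (mirror r)) ≟ bh (mirror t) | suc (bh l) ≟ bh t
  ... | yes _ | yes _ = refl
  ... | no  _ | no  _ =
    trans (cong (λ res → fixL (node black (proj₁ res) x (mirror l)) , suc (proj₂ res))
                (joinLeftW-mirror k q pr))
          (cong (_, _) (fixL-mirror (node black l x (proj₁ (joinRightW r k t)))))
  ... | yes e | no ≢ = ⊥-elim (≢ (trans (sym (bh-mirror p)) (trans e (bh-mirror q))))
  ... | no ≢ | yes e = ⊥-elim (≢ (trans (bh-mirror p) (trans e (sym (bh-mirror q)))))
  joinLeftW-mirror k q (red {l = a} {y} pa pb) =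
    cong (λ res → node red (proj₁ res) y (mirror a) , suc (proj₂ res)) (joinLeftW-mirror k q (black pb))

  JoinSpec-mirror : ∀ {m n tl k tr t w} → RB m tl → RB n tr →
                    JoinSpec (mirror tr) k (mirror tl) t w → JoinSpec tl k tr (mirror t) w
  JoinSpec-mirror {tl = tl} {k} {tr} {t} {w} ptl ptr spec = record
    { inorder-≡ = begin
        inorder (mirror t)                                         ≡⟨ inorder-mirror t ⟩
        reverse (inorder t)                                        ≡⟨ cong reverse S.inorder-≡ ⟩
        reverse (inorder (mirror tr) ++ k ∷ inorder (mirror tl))
          ≡⟨ reverse-++-∷ (inorder (mirror tr)) k _ ⟩
        reverse (inorder (mirror tl)) ++ k ∷ reverse (inorder (mirror tr))
          ≡⟨ cong₂ (λ xs ys → reverse xs ++ k ∷ reverse ys) (inorder-mirror tl) (inorder-mirror tr) ⟩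
        reverse (reverse (inorder tl)) ++ k ∷ reverse (reverse (inorder tr))
          ≡⟨ cong₂ (λ xs ys → xs ++ k ∷ ys)
                   (reverse-involutive (inorder tl)) (reverse-involutive (inorder tr)) ⟩
        inorder tl ++ k ∷ inorder tr                               ∎
    ; isRB      = map₂ RB-mirror S.isRB
    ; rankℕ≤    = subst₂ (λ a b → a ≤ suc b)
                    (sym (rankℕ-mirror (proj₂ S.isRB)))
                    (trans (cong₂ ℕ._⊔_ (rankℕ-mirror ptr) (rankℕ-mirror ptl))
                           (⊔-comm (rankℕ tr) (rankℕ tl)))
                    S.rankℕ≤
    ; work≤     = subst (λ d → w ≤ 3 + d)
                    (trans (cong₂ ∣_-_∣ (rankℕ-mirror ptr) (rankℕ-mirror ptl))
                           (∣-∣-comm (rankℕ tr) (rankℕ tl)))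
                    S.work≤
    }
    where
      module S = JoinSpec spec
      open ≡-Reasoning

  joinLeftW≡mirror-joinRightW : ∀ {h H tl tr} k → RB h tl → RB H tr →
                                joinLeftW tl k tr ≡ map₁ mirror (joinRightW (mirror tr) k (mirror tl))
  joinLeftW≡mirror-joinRightW {tl = tl} {tr} k p q =
    subst₂ (λ a b → joinLeftW a k b ≡ map₁ mirror (joinRightW (mirror tr) k (mirror tl)))
           (mirror-involutive tl) (mirror-involutive tr)
      (joinLeftW-mirror k (RB-mirror p) (RB-mirror q))

  joinLeft-spec : ∀ {h H} tl k tr → RB h tl → RB H tr → h < H →
                  JoinSpec tl k tr (rootFixL (proj₁ (joinLeftW tl k tr))) (suc (proj₂ (joinLeftW tl k tr)))
  joinLeft-spec tl k tr p q h<H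
    rewrite joinLeftW≡mirror-joinRightW k p q
          | rootFixL-mirror (proj₁ (joinRightW (mirror tr) k (mirror tl)))
    = JoinSpec-mirror p q (joinRight-spec (mirror tr) k (mirror tl) (RB-mirror q) (RB-mirror p) h<H)

  RBᵇ-isBlack : ∀ {n t} → RBᵇ n t → isBlack t ≡ true
  RBᵇ-isBlack leaf       = refl
  RBᵇ-isBlack (node _ _) = refl

  node-spec : ∀ {n c tl k tr} → RB n (node c tl k tr) →
              rankℕ (node c tl k tr) ≤ suc (rankℕ tl ℕ.⊔ rankℕ tr) →
              JoinSpec tl k tr (node c tl k tr) 1
  node-spec p rank≤ = record { inorder-≡ = refl ; isRB = _ , p ; rankℕ≤ = rank≤ ; work≤ = s≤s z≤n }

  join-spec : ∀ {m n} tl k tr → RB m tl → RB n tr → JoinSpec tl k tr (join tl k tr) (work tl k tr)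
  join-spec tl k tr p q with <-cmp (bh tl) (bh tr)
  ... | tri< lt _ _ = joinLeft-spec tl k tr p q (subst₂ _<_ (bh-RB p) (bh-RB q) lt)
  ... | tri> _ _ gt = joinRight-spec tl k tr p q (subst₂ _<_ (bh-RB q) (bh-RB p) gt)
  ... | tri≈ _ eq _ with bh≡⇒≡ p q eq
  join-spec tl k tr (black p) (black q) | tri≈ _ _ _ | refl
    rewrite RBᵇ-isBlack p | RBᵇ-isBlack q =
      node-spec (red p q) (s≤s (≤-trans (2*bh≤rankℕ tl) (m≤m⊔n _ _)))
  join-spec tl k tr p@(red _ _) q | tri≈ _ _ _ | refl =
      node-spec (black (node p q))
        (≤-trans (≤-reflexive (*-suc 2 (bh tl))) (s≤s (m≤m⊔n (rankℕ tl) (rankℕ tr))))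
  join-spec {n = n} tl k tr p@(black pᵇ) q@(red _ _) | tri≈ _ _ _ | refl
    rewrite RBᵇ-isBlack pᵇ =
      node-spec (black (node p q))
        (≤-trans (≤-reflexive (trans (rankℕ-RBᵇ (node {k = k} p q))
                                     (trans (*-suc 2 n) (cong suc (sym (rankℕ-red q))))))
                 (s≤s (m≤n⊔m (rankℕ tl) (rankℕ tr))))

  -- Integer ranks

  rank≡rankℕ-2 : ∀ t → rank t ≡ + rankℕ t ℤ.- + 2
  rank≡rankℕ-2 leaf               = refl
  rank≡rankℕ-2 (node black _ _ _) = refl
  rank≡rankℕ-2 (node red l _ _)   = begin
    + (2 * bh l) ℤ.- + 1       ≡⟨ ℤ.[+m]-[+n]≡m⊖n (2 * bh l) 1 ⟩
    2 * bh l ⊖ 1               ≡⟨ ℤ.[1+m]⊖[1+n]≡m⊖n (2 * bh l) 1 ⟨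
    suc (2 * bh l) ⊖ 2         ≡⟨ ℤ.[+m]-[+n]≡m⊖n (suc (2 * bh l)) 2 ⟨
    + suc (2 * bh l) ℤ.- + 2   ∎
    where open ≡-Reasoning

  ∣rank-rank∣≡∣rankℕ-rankℕ∣ : ∀ s t → ∣ rank s ℤ.- rank t ∣ ≡ ∣ rankℕ s - rankℕ t ∣
  ∣rank-rank∣≡∣rankℕ-rankℕ∣ s t rewrite rank≡rankℕ-2 s | rank≡rankℕ-2 t =
    trans (cong ∣_∣ (trans ([i-k]-[j-k]≡i-j (+ rankℕ s) (+ rankℕ t) (+ 2))
                           (ℤ.[+m]-[+n]≡m⊖n (rankℕ s) (rankℕ t))))
          (∣m⊖n∣≡∣m-n∣ (rankℕ s) (rankℕ t))

  rank≤1+rank : ∀ s t → rankℕ s ≤ suc (rankℕ t) → rank s ℤ.≤ + 1 ℤ.+ rank t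
  rank≤1+rank s t rankℕ≤ rewrite rank≡rankℕ-2 s | rank≡rankℕ-2 t =
    subst (+ rankℕ s ℤ.- + 2 ℤ.≤_) (ℤ.+-assoc (+ 1) (+ rankℕ t) (ℤ.- + 2))
          (ℤ.+-monoˡ-≤ (ℤ.- + 2) (ℤ.+≤+ rankℕ≤))

  rank≤1+rank⊔rank : ∀ s tl tr → rankℕ s ≤ suc (rankℕ tl ℕ.⊔ rankℕ tr) →
                     rank s ℤ.≤ + 1 ℤ.+ (rank tl ⊔ rank tr)
  rank≤1+rank⊔rank s tl tr rankℕ≤ with ⊔-sel (rankℕ tl) (rankℕ tr)
  ... | inj₁ ⊔≡ = ℤ.≤-trans (rank≤1+rank s tl (subst (λ m → rankℕ s ≤ suc m) ⊔≡ rankℕ≤))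
                           (ℤ.+-monoʳ-≤ (+ 1) (ℤ.i≤i⊔j (rank tl) (rank tr)))
  ... | inj₂ ⊔≡ = ℤ.≤-trans (rank≤1+rank s tr (subst (λ m → rankℕ s ≤ suc m) ⊔≡ rankℕ≤))
                           (ℤ.+-monoʳ-≤ (+ 1) (ℤ.i≤j⊔i (rank tl) (rank tr)))

lemma2 : Σ ℕ λ c → ∀ {A : Set} (tl : Tree A) (k : A) (tr : Tree A) →
           IsRB tl → IsRB tr →
           (inorder (join tl k tr) ≡ inorder tl ++ k ∷ inorder tr)
           × (work tl k tr ≤ c * suc ∣ rank tl ℤ.- rank tr ∣)
           × IsRB (join tl k tr)
           × (rank (join tl k tr) ℤ.≤ + 1 ℤ.+ (rank tl ⊔ rank tr))
lemma2 = 3 , λ tl k tr ptl ptr →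
  let open JoinSpec (join-spec tl k tr (IsRB⇒RB tl ptl) (IsRB⇒RB tr ptr)) in
  inorder-≡ ,
  ≤-trans work≤ (subst (λ d → 3 + d ≤ 3 * suc ∣ rank tl ℤ.- rank tr ∣)
                       (∣rank-rank∣≡∣rankℕ-rankℕ∣ tl tr) (m+n≤m*[1+n] 3 _)) ,
  RB⇒IsRB (proj₂ isRB) ,
  rank≤1+rank⊔rank (join tl k tr) tl tr rankℕ≤
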